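{- Let $M$ be a matroid on a finite set $E$, and let $P$ and $Q$ be partitions of $\bigcup\mathcal{B}(M)$ such that for every $B\in\mathcal{B}(M)$, every $K\in P$ and every $L\in Q$, $|B\cap K|=1$ and $|B\cap L|=1$. Then $P=Q$.
   Context: $\mathcal{B}(M)$ is the family of bases of $M$. A partition of a set $S$ is a family of nonempty pairwise disjoint subsets of $S$ with union $S$. -}

module Defs where

open import Data.Nat using (ℕ)
open import Data.Bool using (Bool; true)
open import Data.Fin using (Fin)
open import Data.Fin.Subset using (Subset; _∈_; _∉_; _∪_; _∩_; _-_; ⁅_⁆; Nonempty; Empty)
open import Data.Product using (Σ; ∃; _×_)
open import Relation.Binary.PropositionalEquality using (_≡_; _≢_)
open import Relation.Nullary using (¬_)

Family : ℕ → Set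
Family n = Subset n → Bool

_∈F_ : ∀ {n} → Subset n → Family n → Set
K ∈F F = F K ≡ true

record Matroid (n : ℕ) : Set where
  field
    bases        : Family n
    basis-exists : ∃ λ B → B ∈F bases
    exchange     : ∀ B₁ B₂ → B₁ ∈F bases → B₂ ∈F bases →
                   ∀ x → x ∈ B₁ → x ∉ B₂ →
                   ∃ λ y → y ∈ B₂ × y ∉ B₁ × ((B₁ - x) ∪ ⁅ y ⁆) ∈F bases

open Matroid public

InUnionBases : ∀ {n} → Matroid n → Fin n → Set
InUnionBases M e = ∃ λ B → B ∈F bases M × e ∈ B

record IsPartition {n : ℕ} (S : Fin n → Set) (P : Family n) : Set where
  field
    blocks-nonempty : ∀ K → K ∈F P → Nonempty K
    blocks-disjoint : ∀ K L → K ∈F P → L ∈F P → K ≢ L → Empty (K ∩ L)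
    blocks-inside   : ∀ K → K ∈F P → ∀ e → e ∈ K → S e
    covers          : ∀ e → S e → ∃ λ K → K ∈F P × e ∈ K

-- Suppose two blocks K ∈ P and L ∈ Q share an element e, and let f ∈ K lie in a
-- basis B. If e ∈ B, then f = e since B meets K only once. Otherwise take a basis
-- B₂ ∋ e and exchange e for some y ∈ B; the new basis (B₂ - e) ∪ {y} must still meet
-- K and L, and it can only do so at y, because B₂ meets each of them only at e.
-- Thus y ∈ B ∩ K ∩ L, so f = y ∈ L. Hence K ⊆ L, symmetrically L ⊆ K, and as the
-- blocks of Q cover ⋃𝓑(M), every block of P is a block of Q and vice versa.
module Submission where

open import Defs
open import Data.Nat using (ℕ; _≤_; _<_)
open import Data.Nat.Properties using (<⇒≱; ≤-pred)
open import Data.Bool.Properties using (⇔→≡)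
open import Data.Fin.Properties using (_≟_)
open import Data.Fin.Subset using (Subset; _∈_; _∉_; _⊆_; _∩_; _∪_; _─_; _-_; ⁅_⁆; ⊥; ∣_∣; Nonempty)
open import Data.Fin.Subset.Properties
  using ( x∈p∩q⁺; x∈p∩q⁻; x∈p∪q⁻; x∈⁅x⁆; x∈⁅y⁆⇒x≡y; ∣⁅x⁆∣≡1; p⊆q⇒∣p∣≤∣q∣; ∣⊥∣≡0
        ; x∈p∧x≢y⇒x∈p-y; x∈p⇒∣p-x∣<∣p∣; p─q⊆p; Empty-unique; nonempty?; ⊆-antisym; _∈?_ )
open import Data.Product using (_,_)
open import Data.Sum using (inj₁; inj₂)
open import Data.Vec using (_∷_; there)
open import Function using (_∘_)
open import Function.Bundles using (mk⇔)
open import Relation.Nullary using (yes; no; contradiction)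
open import Relation.Binary.PropositionalEquality using (_≡_; sym; trans; subst)

private
  variable
    n : ℕ

x∈p─q⇒x∉q : ∀ {p q : Subset n} {x} → x ∈ p ─ q → x ∉ q
x∈p─q⇒x∉q {p = _ ∷ p} {q = _ ∷ q} (there x∈p─q) (there x∈q) = x∈p─q⇒x∉q {p = p} x∈p─q x∈q

x∈p⇒0<∣p∣ : ∀ {p : Subset n} {x} → x ∈ p → 0 < ∣ p ∣
x∈p⇒0<∣p∣ {p = p} {x} x∈p =
  subst (_≤ ∣ p ∣) (∣⁅x⁆∣≡1 x) (p⊆q⇒∣p∣≤∣q∣ ⁅x⁆⊆p)
  where
    ⁅x⁆⊆p : ⁅ x ⁆ ⊆ p
    ⁅x⁆⊆p y∈⁅x⁆ = subst (_∈ p) (sym (x∈⁅y⁆⇒x≡y x y∈⁅x⁆)) x∈p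

∣p∣≡1⇒nonempty : ∀ {p : Subset n} → ∣ p ∣ ≡ 1 → Nonempty p
∣p∣≡1⇒nonempty {n} {p} ∣p∣≡1 with nonempty? p
... | yes p≢∅ = p≢∅
... | no  p≡∅ = contradiction (trans (sym (∣⊥∣≡0 n)) ∣⊥∣≡1) λ ()
  where
    ∣⊥∣≡1 : ∣ ⊥ {n = n} ∣ ≡ 1
    ∣⊥∣≡1 = subst (λ q → ∣ q ∣ ≡ 1) (Empty-unique p≡∅) ∣p∣≡1

∣p∣≡1⇒x≡y : ∀ {p : Subset n} {x y} → ∣ p ∣ ≡ 1 → x ∈ p → y ∈ p → x ≡ y
∣p∣≡1⇒x≡y {p = p} {x} {y} ∣p∣≡1 x∈p y∈p with x ≟ y
... | yes x≡y = x≡y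
... | no  x≢y = contradiction (≤-pred ∣p-x∣<1) (<⇒≱ (x∈p⇒0<∣p∣ y∈p-x))
  where
    y∈p-x : y ∈ p - x
    y∈p-x = x∈p∧x≢y⇒x∈p-y y∈p (x≢y ∘ sym)
    ∣p-x∣<1 : ∣ p - x ∣ < 1
    ∣p-x∣<1 = subst (∣ p - x ∣ <_) ∣p∣≡1 (x∈p⇒∣p-x∣<∣p∣ x∈p)

MeetsEveryBasisOnce : Matroid n → Subset n → Set
MeetsEveryBasisOnce M K = ∀ B → B ∈F bases M → ∣ B ∩ K ∣ ≡ 1

module _ (M : Matroid n) {K : Subset n} (once : MeetsEveryBasisOnce M K) where

  meetsOnce⇒x≡y : ∀ {B x y} → B ∈F bases M → x ∈ B → x ∈ K → y ∈ B → y ∈ K → x ≡ y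
  meetsOnce⇒x≡y {B} B-basis x∈B x∈K y∈B y∈K =
    ∣p∣≡1⇒x≡y (once B B-basis) (x∈p∩q⁺ (x∈B , x∈K)) (x∈p∩q⁺ (y∈B , y∈K))

  meetsOnce-exchange : ∀ {B e y} → B ∈F bases M → e ∈ B → e ∈ K →
                       ((B - e) ∪ ⁅ y ⁆) ∈F bases M → y ∈ K
  meetsOnce-exchange {B} {e} {y} B-basis e∈B e∈K B′-basis
    with ∣p∣≡1⇒nonempty (once _ B′-basis)
  ... | z , z∈B′∩K with x∈p∩q⁻ _ K z∈B′∩K
  ... | z∈B′ , z∈K with x∈p∪q⁻ (B - e) ⁅ y ⁆ z∈B′
  ... | inj₂ z∈⁅y⁆ = subst (_∈ K) (x∈⁅y⁆⇒x≡y y z∈⁅y⁆) z∈K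
  ... | inj₁ z∈B-e = contradiction (subst (_∈ ⁅ e ⁆) (sym z≡e) (x∈⁅x⁆ e)) (x∈p─q⇒x∉q z∈B-e)
    where
      z≡e : z ≡ e
      z≡e = meetsOnce⇒x≡y B-basis (p─q⊆p B ⁅ e ⁆ z∈B-e) z∈K e∈B e∈K

meetsOnce⇒⊆ : ∀ (M : Matroid n) {K L e} →
              MeetsEveryBasisOnce M K → MeetsEveryBasisOnce M L →
              (∀ f → f ∈ K → InUnionBases M f) → e ∈ K → e ∈ L → K ⊆ L
meetsOnce⇒⊆ M {K} {L} {e} onceK onceL K⊆⋃𝓑 e∈K e∈L {f} f∈K
  with K⊆⋃𝓑 f f∈K | K⊆⋃𝓑 e e∈K
... | B , B-basis , f∈B | B₂ , B₂-basis , e∈B₂ with e ∈? B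
...   | yes e∈B = subst (_∈ L) (meetsOnce⇒x≡y M onceK B-basis e∈B e∈K f∈B f∈K) e∈L
...   | no  e∉B with exchange M B₂ B B₂-basis B-basis e e∈B₂ e∉B
...     | y , y∈B , _ , B′-basis =
  subst (_∈ L) (meetsOnce⇒x≡y M onceK B-basis y∈B y∈K f∈B f∈K) y∈L
  where
    y∈K : y ∈ K
    y∈K = meetsOnce-exchange M onceK B₂-basis e∈B₂ e∈K B′-basis
    y∈L : y ∈ L
    y∈L = meetsOnce-exchange M onceL B₂-basis e∈B₂ e∈L B′-basis

meetsOnce-partitions-⊆ : ∀ (M : Matroid n) {P Q : Family n} →
                IsPartition (InUnionBases M) P → IsPartition (InUnionBases M) Q →
                (∀ K → K ∈F P → MeetsEveryBasisOnce M K) →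
                (∀ L → L ∈F Q → MeetsEveryBasisOnce M L) →
                ∀ K → K ∈F P → K ∈F Q
meetsOnce-partitions-⊆ M {Q = Q} partP partQ onceP onceQ K K∈P
  with IsPartition.blocks-nonempty partP K K∈P
... | e , e∈K with IsPartition.covers partQ e (IsPartition.blocks-inside partP K K∈P e e∈K)
... | L , L∈Q , e∈L = subst (_∈F Q) (sym K≡L) L∈Q
  where
    K≡L : K ≡ L
    K≡L = ⊆-antisym
      (meetsOnce⇒⊆ M (onceP K K∈P) (onceQ L L∈Q) (IsPartition.blocks-inside partP K K∈P) e∈K e∈L)
      (meetsOnce⇒⊆ M (onceQ L L∈Q) (onceP K K∈P) (IsPartition.blocks-inside partQ L L∈Q) e∈L e∈K)

proposition17 : ∀ {n : ℕ} (M : Matroid n) (P Q : Family n) →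
                IsPartition (InUnionBases M) P →
                IsPartition (InUnionBases M) Q →
                (∀ B K → B ∈F bases M → K ∈F P → ∣ B ∩ K ∣ ≡ 1) →
                (∀ B L → B ∈F bases M → L ∈F Q → ∣ B ∩ L ∣ ≡ 1) →
                ∀ (K : Subset n) → P K ≡ Q K
proposition17 M P Q partP partQ onceP onceQ K =
  ⇔→≡ (mk⇔ (meetsOnce-partitions-⊆ M partP partQ onceP′ onceQ′ K)
           (meetsOnce-partitions-⊆ M partQ partP onceQ′ onceP′ K))
  where
    onceP′ : ∀ K → K ∈F P → MeetsEveryBasisOnce M K
    onceP′ K K∈P B B-basis = onceP B K B-basis K∈P
    onceQ′ : ∀ L → L ∈F Q → MeetsEveryBasisOnce M L
    onceQ′ L L∈Q B B-basis = onceQ B L B-basis L∈Q
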